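{- There exists a stubbornness function $D$ such that $Cond^D_{CB}$ is not universal, and there exists a stubbornness function $D$ such that $Lex^D_{CB}$ is not universal; i.e., in each case there is an epistemic space that is identifiable in the limit but is not identified in the limit by the respective confirmation-biased method.
   Context: An epistemic space is a pair $\mathbb{S}=(S,\mathcal{O})$ where $S$ is a nonempty, at most countable set of worlds and $\mathcal{O}\subseteq\mathcal{P}(S)$ a set of observables. A data stream is an infinite sequence $\vec O=(O_0,O_1,\ldots)$ with $O_i\in\mathcal{O}$; $\vec O[n]=(O_0,\ldots,O_{n-1})$. $\vec O$ is sound for $s$ if $s\in O_n$ for all $n$, complete for $s$ if every $O\in\mathcal{O}$ with $s\in O$ occurs in $\vec O$. A learner $L$ assigns to $\mathbb{S}$ and each finite sequence $\sigma$ a subset $L(\mathbb{S},\sigma)\subseteq S$; $s$ is identified in the limit by $L$ on $\vec O$ if there is $k$ with $L(\mathbb{S},\vec O[n])=\{s\}$ for all $n\ge k$; $s$ is identified by $L$ if this holds on every sound and complete stream for $s$; $\mathbb{S}$ is identified by $L$ if every $s\in S$ is; $\mathbb{S}$ is identifiable in the limit if some learner identifies it. A revision method is universal if it identifies in the limit every epistemic space that is identifiable in the limit. A plausibility space is $\mathbb{B}=(S,\mathcal{O},\preceq)$ with $\preceq$ a total preorder on $S$. $Cond_1(\mathbb{B},p)=(S\cap p,\mathcal{O},\preceq\cap((S\cap p)\times(S\cap p)))$; $Lex_1(\mathbb{B},p)=(S,\mathcal{O},\preceq')$ where $t\preceq' w$ iff ($t,w\in p$ and $t\preceq w$) or ($t,w\notin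 p$ and $t\preceq w$) or ($t\in p$ and $w\notin p$). A stubbornness function is $D:\mathcal{P}(S)\to\mathbb{N}$. For $R_1\in\{Cond_1,Lex_1\}$, the confirmation-biased method is $R^D_{CB}(\mathbb{B},\lambda)=\mathbb{B}$ and $R^D_{CB}(\mathbb{B},\sigma\cdot p)=R_1(R^D_{CB}(\mathbb{B},\sigma),p)$ if $\#p(\sigma)\ge D(S\setminus p)$, and $=R^D_{CB}(\mathbb{B},\sigma)$ otherwise, where $\#p(\sigma)$ counts occurrences of $p$ in $\sigma$ ($Cond^D_{CB}$ and $Lex^D_{CB}$ for $R_1=Cond_1,Lex_1$). The learner with prior $\preceq$ outputs the minimal worlds of $R^D_{CB}((S,\mathcal{O},\preceq),\sigma)$, and the method identifies $\mathbb{S}$ in the limit iff for some prior $\preceq$ its learner identifies $\mathbb{S}$ in the limit. -}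

module Defs where

open import Data.Nat using (ℕ; zero; suc; _≤_; _≤?_)
open import Data.Bool using (Bool; true; false; not; if_then_else_)
open import Data.List using (List; []; _∷_)
open import Data.Product using (Σ; _×_; _,_; ∃)
open import Data.Sum using (_⊎_)
open import Data.Unit using (⊤)
open import Relation.Nullary using (¬_; does)
open import Relation.Binary.Core using (Rel)
open import Relation.Binary.Definitions using (DecidableEquality)
open import Relation.Binary.Structures using (IsTotalPreorder)
open import Relation.Binary.PropositionalEquality using (_≡_)
open import Function.Definitions using (Injective)

-- Worlds: a nonempty, at most countable type (injection into ℕ, plus an
-- inhabitant).  Observables: a family of subsets of the worlds, indexed by
-- a type with decidable equality, with distinct indices denoting distinct
-- sets (so the index type is, up to a bijection, the set 𝒪 ⊆ P(S)).
-- Subsets of S are represented as characteristic functions S → Bool.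

record EpistemicSpace : Set₁ where
  field
    World      : Set
    enc        : World → ℕ
    enc-inj    : Injective _≡_ _≡_ enc
    inhabitant : World
    Obs        : Set
    _≟O_       : DecidableEquality Obs
    obs        : Obs → World → Bool
    obs-inj    : ∀ i j → (∀ w → obs i w ≡ obs j w) → i ≡ j

module _ (𝕊 : EpistemicSpace) where
  open EpistemicSpace 𝕊

  Stream : Set
  Stream = ℕ → Obs

  -- finite sequences are stored NEWEST-FIRST: (p ∷ σ) is σ·p
  prefix : Stream → ℕ → List Obs
  prefix O zero    = []
  prefix O (suc n) = O n ∷ prefix O n

  Sound : Stream → World → Set
  Sound O s = ∀ n → obs (O n) s ≡ true

  Complete : Stream → World → Set
  Complete O s = ∀ i → obs i s ≡ true → ∃ λ n → O n ≡ i

  Learner : Set₁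
  Learner = List Obs → World → Set

  OutputsSingleton : (World → Set) → World → Set
  OutputsSingleton X s = ∀ w → (X w → w ≡ s) × (w ≡ s → X w)

  IdentifiesOn : Learner → Stream → World → Set
  IdentifiesOn L O s = ∃ λ k → ∀ n → k ≤ n → OutputsSingleton (L (prefix O n)) s

  IdentifiesWorld : Learner → World → Set
  IdentifiesWorld L s = ∀ O → Sound O s → Complete O s → IdentifiesOn L O s

  IdentifiesSpace : Learner → Set
  IdentifiesSpace L = ∀ s → IdentifiesWorld L s

  IdentifiableInTheLimit : Set₁
  IdentifiableInTheLimit = Σ Learner IdentifiesSpace

  -- Plausibility structures over 𝕊: a current set of worlds (⊆ S) and a
  -- relation on worlds (only its restriction to the current set matters).

  record PlState : Set₁ where
    field
      dom : World → Set
      le  : World → World → Set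

  record Prior : Set₁ where
    field
      _≼_   : Rel World _
      isTPO : IsTotalPreorder _≡_ _≼_

  infix 4 _∈ₒ_ _∉ₒ_
  _∈ₒ_ : World → Obs → Set
  w ∈ₒ p = obs p w ≡ true
  _∉ₒ_ : World → Obs → Set
  w ∉ₒ p = obs p w ≡ false

  Cond₁ : PlState → Obs → PlState
  Cond₁ B p = record
    { dom = λ w → PlState.dom B w × w ∈ₒ p
    ; le  = PlState.le B }

  Lex₁ : PlState → Obs → PlState
  Lex₁ B p = record
    { dom = PlState.dom B
    ; le  = λ t w → (t ∈ₒ p × w ∈ₒ p × PlState.le B t w)
                  ⊎ (t ∉ₒ p × w ∉ₒ p × PlState.le B t w)
                  ⊎ (t ∈ₒ p × w ∉ₒ p) }

  Stubbornness : Set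
  Stubbornness = (World → Bool) → ℕ

  count : Obs → List Obs → ℕ
  count p []      = 0
  count p (q ∷ σ) = if does (p ≟O q) then suc (count p σ) else count p σ

  complementObs : Obs → World → Bool
  complementObs p w = not (obs p w)

  reviseCB : (PlState → Obs → PlState) → Stubbornness → PlState → List Obs → PlState
  reviseCB R₁ D B []      = B
  reviseCB R₁ D B (p ∷ σ) =
    if does (D (complementObs p) ≤? count p σ)
    then R₁ (reviseCB R₁ D B σ) p
    else reviseCB R₁ D B σ

  initialState : Prior → PlState
  initialState P = record { dom = λ _ → ⊤ ; le = Prior._≼_ P }

  Minimal : PlState → World → Set
  Minimal B w = PlState.dom B w × (∀ t → PlState.dom B t → PlState.le B w t)

  methodLearner : (PlState → Obs → PlState) → Stubbornness → Prior → Learner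
  methodLearner R₁ D P σ = Minimal (reviseCB R₁ D (initialState P) σ)

  MethodIdentifies : (PlState → Obs → PlState) → Stubbornness → Set₁
  MethodIdentifies R₁ D = Σ Prior λ P → IdentifiesSpace (methodLearner R₁ D P)

-- R^D_CB is not universal: some identifiable space is not identified by it.
-- (D is chosen for the counterexample space; as D only needs to be defined on
-- P(S) of that space this is equivalent to the paper's ∃D ∃𝕊.)
NotUniversalWitness : (∀ 𝕊 → PlState 𝕊 → EpistemicSpace.Obs 𝕊 → PlState 𝕊) → Set₁
NotUniversalWitness R₁ =
  Σ EpistemicSpace λ 𝕊 → Σ (Stubbornness 𝕊) λ D →
    IdentifiableInTheLimit 𝕊 × ¬ MethodIdentifies 𝕊 (R₁ 𝕊) D

{-# OPTIONS --safe #-}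
-- Take two worlds a, b and the observables {a} and S.  The space is
-- identifiable: guess a once {a} has been seen, b otherwise.  Let the
-- stubbornness of every set containing b be 1, so {a} is only acted upon
-- at its second occurrence.  The stream {a}, S, S, … for a shows it only
-- once, and revising by the tautology S changes neither the worlds nor the
-- order.  So along that stream and along S, S, … (for b) the plausibility
-- state keeps agreeing with the prior, both streams get the same minimal
-- worlds, and no prior can identify both a and b.
module Submission where

open import Defs
open import Data.Product using (_×_; _,_; proj₁; proj₂)
open import Data.Sum using (inj₁; inj₂)
open import Data.Nat using (ℕ; zero; suc; _<_; _+_; _≤?_)
open import Data.Nat.Properties using (m≤m+n; m≤n+m; m<1+n⇒m<n∨m≡n)
open import Data.Bool using (Bool; true; false; if_then_else_)
open import Data.List using (List; []; _∷_)
open import Data.Unit using (tt)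
open import Function using (id)
open import Relation.Nullary using (¬_; yes; no; does)
open import Relation.Binary.Definitions using (DecidableEquality)
open import Relation.Binary.PropositionalEquality using (_≡_; refl; sym; trans)

module _ (𝕊 : EpistemicSpace) where
  open EpistemicSpace 𝕊

  Tautology : Obs → Set
  Tautology p = ∀ w → obs p w ≡ true

module _ (𝕊 : EpistemicSpace) (P : Prior 𝕊) where
  open EpistemicSpace 𝕊
  open Prior P

  Faithful : PlState 𝕊 → Set
  Faithful B = (∀ w → PlState.dom B w)
             × (∀ t w → PlState.le B t w → t ≼ w)
             × (∀ t w → t ≼ w → PlState.le B t w)

  initialState-faithful : Faithful (initialState 𝕊 P)
  initialState-faithful = (λ _ → tt) , (λ _ _ → id) , (λ _ _ → id)

  minimal-faithful-transfer : ∀ {B B′} → Faithful B → Faithful B′ →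
                              ∀ {w} → Minimal 𝕊 B w → Minimal 𝕊 B′ w
  minimal-faithful-transfer (dom , le⇒≼ , _) (dom′ , _ , ≼⇒le′) {w} (_ , least) =
    dom′ w , λ t _ → ≼⇒le′ w t (le⇒≼ w t (least t (dom t)))

  PreservesFaithfulOnTautologies : (PlState 𝕊 → Obs → PlState 𝕊) → Set₁
  PreservesFaithfulOnTautologies R₁ =
    ∀ B p → Tautology 𝕊 p → Faithful B → Faithful (R₁ B p)

  Cond₁-preservesFaithful : PreservesFaithfulOnTautologies (Cond₁ 𝕊)
  Cond₁-preservesFaithful B p taut (dom , le⇒≼ , ≼⇒le) =
    (λ w → dom w , taut w) , le⇒≼ , ≼⇒le

  Lex₁-preservesFaithful : PreservesFaithfulOnTautologies (Lex₁ 𝕊)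
  Lex₁-preservesFaithful B p taut (dom , le⇒≼ , ≼⇒le) =
    dom , lex⇒≼ , λ t w t≼w → inj₁ (taut t , taut w , ≼⇒le t w t≼w)
    where
    lex⇒≼ : ∀ t w → PlState.le (Lex₁ 𝕊 B p) t w → t ≼ w
    lex⇒≼ t w (inj₁ (_ , _ , le)) = le⇒≼ t w le
    lex⇒≼ t w (inj₂ (inj₁ (t∉p , _))) with trans (sym t∉p) (taut t)
    ... | ()
    lex⇒≼ t w (inj₂ (inj₂ (_ , w∉p))) with trans (sym w∉p) (taut w)
    ... | ()

  reviseCB-tautology-faithful :
    ∀ {R₁} → PreservesFaithfulOnTautologies R₁ → ∀ D B σ p → Tautology 𝕊 p →
    Faithful (reviseCB 𝕊 R₁ D B σ) → Faithful (reviseCB 𝕊 R₁ D B (p ∷ σ))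
  reviseCB-tautology-faithful pres D B σ p taut faithful
    with does (D (complementObs 𝕊 p) ≤? count 𝕊 p σ)
  ... | true  = pres _ p taut faithful
  ... | false = faithful

data World : Set where
  a b : World

data Obs : Set where
  only-a everything : Obs

_≟Obs_ : DecidableEquality Obs
only-a     ≟Obs only-a     = yes refl
only-a     ≟Obs everything = no λ ()
everything ≟Obs only-a     = no λ ()
everything ≟Obs everything = yes refl

obs : Obs → World → Bool
obs only-a     a = true
obs only-a     b = false
obs everything _ = true

obs-injective : ∀ i j → (∀ w → obs i w ≡ obs j w) → i ≡ j
obs-injective only-a     only-a     _  = refl
obs-injective everything everything _  = refl
obs-injective only-a     everything eq with eq b
... | ()
obs-injective everything only-a     eq with eq b
... | ()

encode : World → ℕ
encode a = 0
encode b = 1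

encode-injective : ∀ {v w} → encode v ≡ encode w → v ≡ w
encode-injective {a} {a} _ = refl
encode-injective {b} {b} _ = refl

twoWorlds : EpistemicSpace
twoWorlds = record
  { World = World ; enc = encode ; enc-inj = encode-injective ; inhabitant = a
  ; Obs = Obs ; _≟O_ = _≟Obs_ ; obs = obs ; obs-inj = obs-injective }

stubbornAgainstB : Stubbornness twoWorlds
stubbornAgainstB X = if X b then 1 else 0

everything-tautology : Tautology twoWorlds everything
everything-tautology _ = refl

guess : List Obs → World
guess []                = b
guess (only-a     ∷ _) = a
guess (everything ∷ σ) = guess σ

guessLearner : Learner twoWorlds
guessLearner σ w = w ≡ guess σ

guessLearner-singleton : ∀ σ {s} → guess σ ≡ s → OutputsSingleton twoWorlds (guessLearner σ) s
guessLearner-singleton _ g≡s w = (λ w≡g → trans w≡g g≡s) , (λ w≡s → trans w≡s (sym g≡s))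

guess-a-persists : ∀ p σ → guess σ ≡ a → guess (p ∷ σ) ≡ a
guess-a-persists only-a     σ _  = refl
guess-a-persists everything σ eq = eq

guess-after-only-a : ∀ (O : Stream twoWorlds) {m} → O m ≡ only-a →
                     ∀ n → m < n → guess (prefix twoWorlds O n) ≡ a
guess-after-only-a O Om≡a (suc n) m<1+n with m<1+n⇒m<n∨m≡n m<1+n
... | inj₁ m<n  = guess-a-persists (O n) _ (guess-after-only-a O Om≡a n m<n)
... | inj₂ refl rewrite Om≡a = refl

guess-sound-for-b : ∀ {O} → Sound twoWorlds O b → ∀ n → guess (prefix twoWorlds O n) ≡ b
guess-sound-for-b           sound zero    = refl
guess-sound-for-b {O} sound (suc n) with O n | sound n
... | everything | _ = guess-sound-for-b sound n

guessLearner-identifies : IdentifiesSpace twoWorlds guessLearner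
guessLearner-identifies a O _ complete with complete only-a refl
... | m , Om≡a =
  suc m , λ n m<n →
    guessLearner-singleton (prefix twoWorlds O n) (guess-after-only-a O Om≡a n m<n)
guessLearner-identifies b O sound _ =
  0 , λ n _ → guessLearner-singleton (prefix twoWorlds O n) (guess-sound-for-b sound n)

streamA : Stream twoWorlds
streamA zero    = only-a
streamA (suc _) = everything

streamB : Stream twoWorlds
streamB _ = everything

streamA-sound : Sound twoWorlds streamA a
streamA-sound zero    = refl
streamA-sound (suc _) = refl

streamA-complete : Complete twoWorlds streamA a
streamA-complete only-a     _ = 0 , refl
streamA-complete everything _ = 1 , refl

streamB-sound : Sound twoWorlds streamB b
streamB-sound _ = refl

streamB-complete : Complete twoWorlds streamB b
streamB-complete everything _ = 0 , refl

module _ (P : Prior twoWorlds) {R₁ : PlState twoWorlds → Obs → PlState twoWorlds}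
         (pres : PreservesFaithfulOnTautologies twoWorlds P R₁) where

  revise : List Obs → PlState twoWorlds
  revise = reviseCB twoWorlds R₁ stubbornAgainstB (initialState twoWorlds P)

  stateAfter : Stream twoWorlds → ℕ → PlState twoWorlds
  stateAfter O n = revise (prefix twoWorlds O n)

  revise-everything-faithful : ∀ σ → Faithful twoWorlds P (revise σ) →
                               Faithful twoWorlds P (revise (everything ∷ σ))
  revise-everything-faithful σ =
    reviseCB-tautology-faithful twoWorlds P pres stubbornAgainstB _ σ everything everything-tautology

  -- The single only-a is ignored: its stubbornness is 1 but it has been seen 0 times before.
  streamA-faithful : ∀ n → Faithful twoWorlds P (stateAfter streamA n)
  streamA-faithful zero          = initialState-faithful twoWorlds P
  streamA-faithful (suc zero)    = initialState-faithful twoWorlds P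
  streamA-faithful (suc (suc n)) =
    revise-everything-faithful (prefix twoWorlds streamA (suc n)) (streamA-faithful (suc n))

  streamB-faithful : ∀ n → Faithful twoWorlds P (stateAfter streamB n)
  streamB-faithful zero    = initialState-faithful twoWorlds P
  streamB-faithful (suc n) = revise-everything-faithful (prefix twoWorlds streamB n) (streamB-faithful n)

  reviseCB-not-identifying : ¬ IdentifiesSpace twoWorlds (methodLearner twoWorlds R₁ stubbornAgainstB P)
  reviseCB-not-identifying identifies
    with identifies a streamA streamA-sound streamA-complete
       | identifies b streamB streamB-sound streamB-complete
  ... | kA , singletonA | kB , singletonB
    with proj₁ (singletonB (kA + kB) (m≤n+m kB kA) a) minimalB
    where
    minimalA : Minimal twoWorlds (stateAfter streamA (kA + kB)) a
    minimalA = proj₂ (singletonA (kA + kB) (m≤m+n kA kB) a) refl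
    minimalB : Minimal twoWorlds (stateAfter streamB (kA + kB)) a
    minimalB = minimal-faithful-transfer twoWorlds P
                 (streamA-faithful (kA + kB)) (streamB-faithful (kA + kB)) minimalA
  ... | ()

notUniversal : ∀ {R₁} → (∀ P → PreservesFaithfulOnTautologies twoWorlds P (R₁ twoWorlds)) →
               NotUniversalWitness R₁
notUniversal pres =
  twoWorlds , stubbornAgainstB , (guessLearner , guessLearner-identifies) ,
  λ (P , identifies) → reviseCB-not-identifying P (pres P) identifies

mainTheorem2 : NotUniversalWitness Cond₁ × NotUniversalWitness Lex₁
mainTheorem2 =
  notUniversal (Cond₁-preservesFaithful twoWorlds) , notUniversal (Lex₁-preservesFaithful twoWorlds)
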